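{- Let $G$ be a chordal graph. Then the multiset $\mathbf{S}(G')$ satisfies the Helly property for every induced subgraph $G'$ of $G$ if and only if $G$ is Hajós-free.
   Context: Graphs are simple, finite and undirected; a graph is chordal if it has no induced cycle of length at least four. A clique is a maximal set of pairwise adjacent vertices. A clique tree of a connected chordal graph $G$ is a tree $\mathcal{T}$ whose vertices are the cliques of $G$ such that for any two cliques $C_1,C_2$, every clique on the path from $C_1$ to $C_2$ in $\mathcal{T}$ contains $C_1\cap C_2$. Each edge of a clique tree is labeled by the intersection of its two endpoint cliques; these labels are exactly the minimal vertex separators. $\mathbf{S}(G)$ denotes the multiset of edge labels of a clique tree (taken over all connected components of $G$); it does not depend on the choice of clique tree. A family $\mathcal{F}$ of sets satisfies the Helly property if every subfamily $\mathcal{F}'\subseteq\mathcal{F}$ of pairwise intersecting sets has $\bigcap_{F\in\mathcal{F}'}F\neq\emptyset$. The Hajós graph (3-sun) has vertices $x,y,z,a,b,c$ with edges $xy,yz,xz,ax,ay,bx,bz,cy,cz$. A graph is $H$-free if it has no induced subgraph isomorphic to $H$. (In the paper this is phrased as: the hereditary class of chordal graphs whose minimal separator multiset satisfies the Helly property is exactly the class of Hajós-free chordal graphs.) -}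

module Defs where

open import Data.Bool using (Bool; true; false; _∨_; _∧_)
open import Data.Nat using (ℕ; zero; suc; _≡ᵇ_)
open import Data.Fin using (Fin; toℕ; zero; suc)
open import Data.Fin.Subset using (Subset; _∈_; _⊆_; _∩_; Nonempty)
open import Data.Product using (Σ; ∃; ∃-syntax; _×_; _,_; proj₁; proj₂)
open import Data.Sum using (_⊎_)
open import Data.Maybe using (just)
open import Data.List using (List; head; last; length; lookup)
open import Data.List.Relation.Unary.Linked using (Linked)
open import Data.List.Relation.Unary.Unique.Propositional using (Unique)
import Data.List.Membership.Propositional as L
open import Relation.Nullary using (¬_)
open import Relation.Binary.PropositionalEquality using (_≡_; _≢_)
open import Relation.Binary.Construct.Closure.ReflexiveTransitive using (Star)
open import Function.Definitions using (Injective)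
open import Function.Bundles using (_⇔_)

record Graph : Set where
  field
    n      : ℕ
    adj    : Fin n → Fin n → Bool
    sym    : ∀ u v → adj u v ≡ adj v u
    irrefl : ∀ u → adj u u ≡ false

open Graph public

-- The induced subgraph of G on the image of an (injective) map f : Fin m → V(G).
induced : (G : Graph) (m : ℕ) → (Fin m → Fin (n G)) → Graph
induced G m f = record
  { n = m
  ; adj = λ i j → adj G (f i) (f j)
  ; sym = λ i j → sym G (f i) (f j)
  ; irrefl = λ i → irrefl G (f i)
  }

HasInduced : (G : Graph) (k : ℕ) → (Fin k → Fin k → Bool) → Set
HasInduced G k H =
  Σ (Fin k → Fin (n G)) λ f →
    Injective _≡_ _≡_ f × (∀ i j → adj G (f i) (f j) ≡ H i j)

-- adjacency of the cycle C_k on Fin k (i ~ i+1 mod k)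
cycleAdj : (k : ℕ) → Fin k → Fin k → Bool
cycleAdj k i j =
  (suc (toℕ i) ≡ᵇ toℕ j) ∨ (suc (toℕ j) ≡ᵇ toℕ i)
  ∨ ((toℕ i ≡ᵇ 0) ∧ (suc (toℕ j) ≡ᵇ k))
  ∨ ((toℕ j ≡ᵇ 0) ∧ (suc (toℕ i) ≡ᵇ k))

Chordal : Graph → Set
Chordal G = ∀ k → 4 Data.Nat.≤ k → ¬ HasInduced G k (cycleAdj k)

-- The Hajós graph (3-sun): x=0, y=1, z=2, a=3, b=4, c=5
-- edges xy, yz, xz, ax, ay, bx, bz, cy, cz

hajosEdge : Fin 6 → Fin 6 → Bool
hajosEdge zero (suc zero) = true
hajosEdge (suc zero) (suc (suc zero)) = true
hajosEdge zero (suc (suc zero)) = true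
hajosEdge (suc (suc (suc zero))) zero = true
hajosEdge (suc (suc (suc zero))) (suc zero) = true
hajosEdge (suc (suc (suc (suc zero)))) zero = true
hajosEdge (suc (suc (suc (suc zero)))) (suc (suc zero)) = true
hajosEdge (suc (suc (suc (suc (suc zero))))) (suc zero) = true
hajosEdge (suc (suc (suc (suc (suc zero))))) (suc (suc zero)) = true
hajosEdge _ _ = false

hajosAdj : Fin 6 → Fin 6 → Bool
hajosAdj i j = hajosEdge i j ∨ hajosEdge j i

HajosFree : Graph → Set
HajosFree G = ¬ HasInduced G 6 hajosAdj

module _ (G : Graph) where

  IsComplete : Subset (n G) → Set
  IsComplete C = ∀ u v → u ∈ C → v ∈ C → u ≢ v → adj G u v ≡ true

  IsClique : Subset (n G) → Set
  IsClique C = IsComplete C × Nonempty C × (∀ D → IsComplete D → C ⊆ D → D ⊆ C)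

  Connected : Fin (n G) → Fin (n G) → Set
  Connected = Star (λ u v → adj G u v ≡ true)

-- Clique trees (one per connected component, i.e. a clique forest)

record CliqueForest (G : Graph) : Set where
  field
    m        : ℕ
    clique   : Fin m → Subset (n G)
    isClique : ∀ i → IsClique G (clique i)
    injC     : Injective _≡_ _≡_ clique
    allC     : ∀ C → IsClique G C → ∃[ i ] clique i ≡ C
    edges    : List (Fin m × Fin m)

  TAdj : Fin m → Fin m → Set
  TAdj i j = ((i , j) L.∈ edges) ⊎ ((j , i) L.∈ edges)

  SimplePath : Fin m → Fin m → List (Fin m) → Set
  SimplePath i j p = Linked TAdj p × Unique p × head p ≡ just i × last p ≡ just j

  SameEdge : (Fin m × Fin m) → (Fin m × Fin m) → Set
  SameEdge (i , j) (k , l) = (i ≡ k × j ≡ l) ⊎ (i ≡ l × j ≡ k)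

  field
    noLoop       : ∀ i → ¬ TAdj i i
    noMultiEdge  : ∀ a b → SameEdge (lookup edges a) (lookup edges b) → a ≡ b
    acyclic      : ∀ i j p q → SimplePath i j p → SimplePath i j q → p ≡ q
    components   : ∀ i j → (∃[ p ] SimplePath i j p) ⇔
                     (∃[ u ] ∃[ v ] (u ∈ clique i × v ∈ clique j × Connected G u v))
    intersection : ∀ i j p → SimplePath i j p → ∀ k → k L.∈ p →
                     (clique i ∩ clique j) ⊆ clique k

  -- edge labels: S(G) as an indexed family (a multiset)
  labels : Fin (length edges) → Subset (n G)
  labels a = clique (proj₁ (lookup edges a)) ∩ clique (proj₂ (lookup edges a))

Helly : {n k : ℕ} → (Fin k → Subset n) → Set
Helly {n} {k} F =
  ∀ (P : Subset k) → Nonempty P →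
    (∀ a b → a ∈ P → b ∈ P → Nonempty (F a ∩ F b)) →
    ∃[ v ] (∀ a → a ∈ P → v ∈ F a)

-- S(G) satisfies the Helly property (S(G) is independent of the clique forest)
SHelly : Graph → Set
SHelly G = ∀ (T : CliqueForest G) → Helly (CliqueForest.labels T)

module Submission where

-- (⇐) Every separator label is an intersection C ∩ D of two cliques.  A finite
-- family of sets is Helly as soon as it contains no "triangle": three members
-- X₁ X₂ X₃ with points vᵢ ∉ Xᵢ lying in the other two members (induction on the
-- size of a pairwise intersecting subfamily).  A triangle of intersections of
-- cliques enlarges to a triangle of cliques, and a triangle of cliques in a
-- chordal graph yields an induced Hajós graph: the vᵢ are pairwise adjacent,
-- each Xᵢ contains a vertex aᵢ not adjacent to vᵢ, and an edge aᵢaⱼ would close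
-- an induced 4-cycle.  Hereditariness passes both hypotheses to induced subgraphs.
--
-- (⇒) An induced copy of the Hajós graph has the star clique tree with centre
-- {x,y,z} and leaves {x,y,a}, {x,z,b}, {y,z,c}; its labels {x,y}, {x,z}, {y,z}
-- pairwise meet but have no common vertex.

open import Defs
open import Data.Bool using (Bool; true; false)
import Data.Bool.Properties as Bool
open import Data.Nat using (ℕ; zero; suc; s≤s; z≤n; _<_)
open import Data.Nat.Properties using (<-≤-trans; ≤-pred; ≤-refl)
open import Data.Fin using (Fin; zero; suc; toℕ)
import Data.Fin.Properties as Fin
open import Data.Fin.Subset
  using (Subset; _∈_; _∉_; _⊆_; _∩_; _∪_; _─_; _-_; ∣_∣; ⁅_⁆; ⊤; Nonempty; inside; outside)
open import Data.Fin.Subset.Properties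
  using ( _∈?_; _⊆?_; nonempty?; anySubset?; ⊆-antisym; ∈⊤; x∈⁅x⁆; x∈⁅y⁆⇒x≡y
        ; x∈p∪q⁺; x∈p∪q⁻; x∈p∩q⁺; x∈p∩q⁻; p─q⊆p; x∈p∧x≢y⇒x∈p-y; x∈p⇒∣p-x∣<∣p∣ )
open import Data.Vec using ([]; _∷_; here; there)
import Data.Vec.Properties as Vec
open import Data.Product using (∃; ∃-syntax; _×_; _,_; proj₁; proj₂)
import Data.Product.Properties as Product
open import Data.Sum using (_⊎_; inj₁; inj₂)
open import Data.Empty using (⊥; ⊥-elim)
open import Data.Maybe using (just)
import Data.Maybe.Properties as Maybe
open import Data.List using (List; []; _∷_; head; last; lookup)
import Data.List.Properties as List
open import Data.List.Relation.Unary.Any using (any?)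
open import Data.List.Relation.Unary.Linked using (Linked; [-]; _∷_; linked?)
open import Data.List.Relation.Unary.AllPairs using (_∷_; allPairs?)
open import Data.List.Relation.Unary.All using (_∷_)
open import Data.List.Relation.Unary.Unique.Propositional using (Unique)
import Data.List.Membership.Propositional as L
open import Relation.Nullary using (¬_; Dec; yes; no)
open import Relation.Nullary.Decidable using (from-yes; from-no; _×-dec_; _⊎-dec_; _→-dec_; ¬?)
open import Relation.Binary.Definitions using (tri<; tri≈; tri>)
open import Relation.Binary.PropositionalEquality
  using (_≡_; _≢_; refl; trans; cong; subst; module ≡-Reasoning) renaming (sym to ≡-sym)
open import Relation.Binary.Construct.Closure.ReflexiveTransitive using (ε; _◅_; _◅◅_)
open import Function.Definitions using (Injective)
open import Function.Bundles using (_⇔_; mk⇔)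

pattern #0 = zero
pattern #1 = suc #0
pattern #2 = suc #1
pattern #3 = suc #2
pattern #4 = suc #3
pattern #5 = suc #4

-- A symmetric relation on Fin k holding on the diagonal holds everywhere once it
-- holds strictly above the diagonal; this halves every finite adjacency check.
upper-triangle : ∀ {k} (P : Fin k → Fin k → Set) → (∀ i → P i i) →
                 (∀ {i j} → P i j → P j i) → (∀ i j → toℕ i < toℕ j → P i j) → ∀ i j → P i j
upper-triangle P diagonal symmetric above i j with Fin.<-cmp i j
... | tri< i<j _ _ = above i j i<j
... | tri≈ _ refl _ = diagonal i
... | tri> _ _ j<i = symmetric (above j i j<i)

injective-upper : ∀ {k} {B : Set} (g : Fin k → B) → (∀ i j → toℕ i < toℕ j → g i ≢ g j) →
                  Injective _≡_ _≡_ g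
injective-upper g apart {i} {j} =
  upper-triangle (λ i j → g i ≡ g j → i ≡ j) (λ _ _ → refl)
    (λ injective e → ≡-sym (injective (≡-sym e)))
    (λ i j i<j e → ⊥-elim (apart i j i<j e)) i j

false≢true : false ≢ true
false≢true ()

x∈p─q⇒x∉q : ∀ {m} (p q : Subset m) {x} → x ∈ p ─ q → x ∉ q
x∈p─q⇒x∉q (_ ∷ p) (_ ∷ q) (there x∈p─q) (there x∈q) = x∈p─q⇒x∉q p q x∈p─q x∈q
x∈p─q⇒x∉q (_ ∷ p) (inside ∷ q) () here

x∈p-y⇒x≢y : ∀ {m} {p : Subset m} {x y} → x ∈ p - y → x ≢ y
x∈p-y⇒x≢y {p = p} {y = y} x∈p-y refl = x∈p─q⇒x∉q p ⁅ y ⁆ x∈p-y (x∈⁅x⁆ y)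

x∈p-y⇒x∈p : ∀ {m} {p : Subset m} {x y} → x ∈ p - y → x ∈ p
x∈p-y⇒x∈p {p = p} {y = y} = p─q⊆p p ⁅ y ⁆

record Triangle {m} (X₁ X₂ X₃ : Subset m) : Set where
  field
    v₁ v₂ v₃ : Fin m
    v₁∉X₁ : v₁ ∉ X₁
    v₂∈X₁ : v₂ ∈ X₁
    v₃∈X₁ : v₃ ∈ X₁
    v₁∈X₂ : v₁ ∈ X₂
    v₂∉X₂ : v₂ ∉ X₂
    v₃∈X₂ : v₃ ∈ X₂
    v₁∈X₃ : v₁ ∈ X₃
    v₂∈X₃ : v₂ ∈ X₃
    v₃∉X₃ : v₃ ∉ X₃

triangle-enlarge : ∀ {m} {S₁ S₂ S₃ X₁ X₂ X₃ : Subset m} (t : Triangle S₁ S₂ S₃) →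
                   S₁ ⊆ X₁ → S₂ ⊆ X₂ → S₃ ⊆ X₃ →
                   Triangle.v₁ t ∉ X₁ → Triangle.v₂ t ∉ X₂ → Triangle.v₃ t ∉ X₃ →
                   Triangle X₁ X₂ X₃
triangle-enlarge t S₁⊆X₁ S₂⊆X₂ S₃⊆X₃ v₁∉X₁ v₂∉X₂ v₃∉X₃ = record
  { v₁ = v₁ ; v₂ = v₂ ; v₃ = v₃
  ; v₁∉X₁ = v₁∉X₁ ; v₂∈X₁ = S₁⊆X₁ v₂∈X₁ ; v₃∈X₁ = S₁⊆X₁ v₃∈X₁
  ; v₁∈X₂ = S₂⊆X₂ v₁∈X₂ ; v₂∉X₂ = v₂∉X₂ ; v₃∈X₂ = S₂⊆X₂ v₃∈X₂
  ; v₁∈X₃ = S₃⊆X₃ v₁∈X₃ ; v₂∈X₃ = S₃⊆X₃ v₂∈X₃ ; v₃∉X₃ = v₃∉X₃ }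
  where open Triangle t hiding (v₁∉X₁; v₂∉X₂; v₃∉X₃)

data Shape {k} (P : Subset k) : Set where
  at-most-two : ∀ e₁ e₂ → e₁ ∈ P → e₂ ∈ P → (∀ a → a ∈ P → a ≡ e₁ ⊎ a ≡ e₂) → Shape P
  three       : ∀ e₁ e₂ e₃ → e₁ ∈ P → e₂ ∈ P → e₃ ∈ P →
                e₂ ≢ e₁ → e₃ ≢ e₁ → e₃ ≢ e₂ → Shape P

shape : ∀ {k} {P : Subset k} → Nonempty P → Shape P
shape {P = P} (e₁ , e₁∈P) with nonempty? (P - e₁)
... | no ∅₁ = at-most-two e₁ e₁ e₁∈P e₁∈P (λ a a∈P → inj₁ (only ∅₁ a∈P))
  where
  only : ∀ {Q e a} → ¬ Nonempty (Q - e) → a ∈ Q → a ≡ e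
  only {e = e} {a} ∅ a∈Q with a Fin.≟ e
  ... | yes a≡e = a≡e
  ... | no a≢e = ⊥-elim (∅ (a , x∈p∧x≢y⇒x∈p-y a∈Q a≢e))
... | yes (e₂ , e₂∈P-e₁) with nonempty? (P - e₁ - e₂)
...   | yes (e₃ , e₃∈P-e₁-e₂) =
  three e₁ e₂ e₃ e₁∈P (x∈p-y⇒x∈p e₂∈P-e₁) (x∈p-y⇒x∈p e₃∈P-e₁)
        (x∈p-y⇒x≢y e₂∈P-e₁) (x∈p-y⇒x≢y e₃∈P-e₁) (x∈p-y⇒x≢y e₃∈P-e₁-e₂)
  where e₃∈P-e₁ = x∈p-y⇒x∈p e₃∈P-e₁-e₂
...   | no ∅₂ = at-most-two e₁ e₂ e₁∈P (x∈p-y⇒x∈p e₂∈P-e₁) two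
  where
  two : ∀ a → a ∈ P → a ≡ e₁ ⊎ a ≡ e₂
  two a a∈P with a Fin.≟ e₁ | a Fin.≟ e₂
  ... | yes a≡e₁ | _ = inj₁ a≡e₁
  ... | no _ | yes a≡e₂ = inj₂ a≡e₂
  ... | no a≢e₁ | no a≢e₂ =
    ⊥-elim (∅₂ (a , x∈p∧x≢y⇒x∈p-y (x∈p∧x≢y⇒x∈p-y a∈P a≢e₁) a≢e₂))

module _ {m k} (F : Fin k → Subset m) where

  Pairwise : Subset k → Set
  Pairwise P = ∀ a b → a ∈ P → b ∈ P → Nonempty (F a ∩ F b)

  CommonPoint : Subset k → Fin m → Set
  CommonPoint P v = ∀ a → a ∈ P → v ∈ F a

  extend : ∀ {P e v} → CommonPoint (P - e) v → v ∈ F e → CommonPoint P v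
  extend {e = e} common v∈Fe a a∈P with a Fin.≟ e
  ... | yes refl = v∈Fe
  ... | no a≢e = common a (x∈p∧x≢y⇒x∈p-y a∈P a≢e)

  restrict : ∀ {P e v a} → CommonPoint (P - e) v → a ∈ P → a ≢ e → v ∈ F a
  restrict common a∈P a≢e = common _ (x∈p∧x≢y⇒x∈p-y a∈P a≢e)

  -- The inductive step: if, for three distinct members eᵢ, each P - eᵢ has a
  -- common point vᵢ, then some vᵢ is common to P, or (vᵢ) is a triangle on (F eᵢ).
  common-of-three : (∀ a b c → ¬ Triangle (F a) (F b) (F c)) →
                    ∀ {P e₁ e₂ e₃} → e₁ ∈ P → e₂ ∈ P → e₃ ∈ P →
                    e₂ ≢ e₁ → e₃ ≢ e₁ → e₃ ≢ e₂ →
                    ∃ (CommonPoint (P - e₁)) → ∃ (CommonPoint (P - e₂)) →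
                    ∃ (CommonPoint (P - e₃)) → ∃ (CommonPoint P)
  common-of-three no-triangle {e₁ = e₁} {e₂} {e₃} e₁∈P e₂∈P e₃∈P e₂≢e₁ e₃≢e₁ e₃≢e₂
                  (v₁ , common₁) (v₂ , common₂) (v₃ , common₃)
    with v₁ ∈? F e₁ | v₂ ∈? F e₂ | v₃ ∈? F e₃
  ... | yes v₁∈F₁ | _ | _ = v₁ , extend common₁ v₁∈F₁
  ... | no _ | yes v₂∈F₂ | _ = v₂ , extend common₂ v₂∈F₂
  ... | no _ | no _ | yes v₃∈F₃ = v₃ , extend common₃ v₃∈F₃
  ... | no v₁∉F₁ | no v₂∉F₂ | no v₃∉F₃ = ⊥-elim (no-triangle e₁ e₂ e₃ (record
    { v₁ = v₁ ; v₂ = v₂ ; v₃ = v₃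
    ; v₁∉X₁ = v₁∉F₁
    ; v₂∈X₁ = restrict common₂ e₁∈P (≢-sym e₂≢e₁)
    ; v₃∈X₁ = restrict common₃ e₁∈P (≢-sym e₃≢e₁)
    ; v₁∈X₂ = restrict common₁ e₂∈P e₂≢e₁
    ; v₂∉X₂ = v₂∉F₂
    ; v₃∈X₂ = restrict common₃ e₂∈P (≢-sym e₃≢e₂)
    ; v₁∈X₃ = restrict common₁ e₃∈P e₃≢e₁
    ; v₂∈X₃ = restrict common₂ e₃∈P e₃≢e₂
    ; v₃∉X₃ = v₃∉F₃ }))
    where
    ≢-sym : ∀ {a b : Fin k} → a ≢ b → b ≢ a
    ≢-sym a≢b b≡a = a≢b (≡-sym b≡a)

  -- Induction on the size of P: subfamilies of size at most two have a common
  -- point by pairwise intersection, larger ones by the inductive step.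
  helly-below : (∀ a b c → ¬ Triangle (F a) (F b) (F c)) →
                ∀ N P → ∣ P ∣ < N → Nonempty P → Pairwise P → ∃ (CommonPoint P)
  helly-below no-triangle (suc N) P |P|≤N nonempty pairwise with shape nonempty
  ... | at-most-two e₁ e₂ e₁∈P e₂∈P covered = v , common
    where
    v = proj₁ (pairwise e₁ e₂ e₁∈P e₂∈P)
    v∈F₁∩F₂ = proj₂ (pairwise e₁ e₂ e₁∈P e₂∈P)
    common : CommonPoint P v
    common a a∈P with covered a a∈P
    ... | inj₁ refl = proj₁ (x∈p∩q⁻ (F e₁) (F e₂) v∈F₁∩F₂)
    ... | inj₂ refl = proj₂ (x∈p∩q⁻ (F e₁) (F e₂) v∈F₁∩F₂)
  ... | three e₁ e₂ e₃ e₁∈P e₂∈P e₃∈P e₂≢e₁ e₃≢e₁ e₃≢e₂ =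
    common-of-three no-triangle e₁∈P e₂∈P e₃∈P e₂≢e₁ e₃≢e₁ e₃≢e₂
      (without e₁∈P e₂∈P e₂≢e₁)
      (without e₂∈P e₁∈P (λ e → e₂≢e₁ (≡-sym e)))
      (without e₃∈P e₁∈P (λ e → e₃≢e₁ (≡-sym e)))
    where
    without : ∀ {e a} → e ∈ P → a ∈ P → a ≢ e → ∃ (CommonPoint (P - e))
    without {e} {a} e∈P a∈P a≢e =
      helly-below no-triangle N (P - e) (<-≤-trans (x∈p⇒∣p-x∣<∣p∣ e∈P) (≤-pred |P|≤N))
        (a , x∈p∧x≢y⇒x∈p-y a∈P a≢e)
        (λ a b a∈ b∈ → pairwise a b (x∈p-y⇒x∈p a∈) (x∈p-y⇒x∈p b∈))

  helly-of-triangle-free : (∀ a b c → ¬ Triangle (F a) (F b) (F c)) → Helly F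
  helly-of-triangle-free no-triangle P = helly-below no-triangle (suc ∣ P ∣) P (s≤s ≤-refl)

induced-copy : ∀ (G : Graph) m (f : Fin m → Fin (n G)) → Injective _≡_ _≡_ f →
               ∀ k A → HasInduced (induced G m f) k A → HasInduced G k A
induced-copy G m f f-injective k A (g , g-injective , g-realises) =
  (λ i → f (g i)) , (λ e → g-injective (f-injective e)) , g-realises

chordal-induced : ∀ (G : Graph) m (f : Fin m → Fin (n G)) → Injective _≡_ _≡_ f →
                  Chordal G → Chordal (induced G m f)
chordal-induced G m f f-injective chordal k 4≤k copy =
  chordal k 4≤k (induced-copy G m f f-injective k (cycleAdj k) copy)

hajosFree-induced : ∀ (G : Graph) m (f : Fin m → Fin (n G)) → Injective _≡_ _≡_ f →
                    HajosFree G → HajosFree (induced G m f)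
hajosFree-induced G m f f-injective hajosFree copy =
  hajosFree (induced-copy G m f f-injective 6 hajosAdj copy)

TwinFree : ∀ {k} → (Fin k → Fin k → Bool) → Set
TwinFree A = ∀ i j → (∀ l → A i l ≡ A j l) → i ≡ j

module Realisation (H : Graph) {k} (A : Fin k → Fin k → Bool) (g : Fin k → Fin (n H)) where

  Realises : Set
  Realises = ∀ i j → adj H (g i) (g j) ≡ A i j

  realises-upper : (∀ i j → A i j ≡ A j i) → (∀ i → A i i ≡ false) →
                   (∀ i j → toℕ i < toℕ j → adj H (g i) (g j) ≡ A i j) → Realises
  realises-upper A-symmetric A-irreflexive =
    upper-triangle (λ i j → adj H (g i) (g j) ≡ A i j)
      (λ i → trans (irrefl H (g i)) (≡-sym (A-irreflexive i)))
      (λ {i} {j} e → trans (sym H (g j) (g i)) (trans e (A-symmetric i j)))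

  -- A realisation of a twin-free pattern is injective: g i ≡ g j forces i and j
  -- to have the same neighbourhood in A.
  realisation-injective : TwinFree A → Realises → Injective _≡_ _≡_ g
  realisation-injective twinFree realises {i} {j} gi≡gj = twinFree i j same-row
    where
    same-row : ∀ l → A i l ≡ A j l
    same-row l = begin
      A i l             ≡⟨ ≡-sym (realises i l) ⟩
      adj H (g i) (g l) ≡⟨ cong (λ v → adj H v (g l)) gi≡gj ⟩
      adj H (g j) (g l) ≡⟨ realises j l ⟩
      A j l             ∎
      where open ≡-Reasoning

module Cliques (H : Graph) where

  Vertex : Set
  Vertex = Fin (n H)

  infix 4 _∼_ _≁_
  _∼_ _≁_ : Vertex → Vertex → Set
  u ∼ v = adj H u v ≡ true
  u ≁ v = adj H u v ≡ false

  ∼-sym : ∀ {u v} → u ∼ v → v ∼ u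
  ∼-sym {u} {v} u∼v = trans (sym H v u) u∼v

  separated : ∀ {w u v} → w ∼ u → w ≁ v → u ≢ v
  separated w∼u w≁v refl = false≢true (trans (≡-sym w≁v) w∼u)

  ∼-distinct : ∀ {u v} → u ∼ v → u ≢ v
  ∼-distinct {u} u∼v u≡v = separated u∼v (irrefl H u) (≡-sym u≡v)

  ∈-∉-distinct : ∀ {X : Subset (n H)} {u v} → u ∈ X → v ∉ X → u ≢ v
  ∈-∉-distinct u∈X v∉X refl = v∉X u∈X

  clique-∼ : ∀ {X} → IsClique H X → ∀ {u v} → u ∈ X → v ∈ X → u ≢ v → u ∼ v
  clique-∼ (complete , _) = complete _ _

  -- Maximality: a vertex outside a clique misses some vertex of it, since
  -- otherwise the clique extended by v would still be complete.
  non-neighbour : ∀ {X} → IsClique H X → ∀ {v} → v ∉ X → ∃[ a ] (a ∈ X × v ≁ a)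
  non-neighbour {X} (complete , _ , maximal) {v} v∉X
    with Fin.any? (λ a → (a ∈? X) ×-dec (adj H v a Bool.≟ false))
  ... | yes found = found
  ... | no none = ⊥-elim (v∉X (maximal (X ∪ ⁅ v ⁆) extended-complete
                                  (λ a∈X → x∈p∪q⁺ (inj₁ a∈X)) (x∈p∪q⁺ (inj₂ (x∈⁅x⁆ v)))))
    where
    v∼X : ∀ a → a ∈ X → v ∼ a
    v∼X a a∈X = Bool.¬-not (λ v≁a → none (a , a∈X , v≁a))
    extended-complete : IsComplete H (X ∪ ⁅ v ⁆)
    extended-complete u w u∈ w∈ u≢w with x∈p∪q⁻ X ⁅ v ⁆ u∈ | x∈p∪q⁻ X ⁅ v ⁆ w∈
    ... | inj₁ u∈X | inj₁ w∈X = complete u w u∈X w∈X u≢w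
    ... | inj₁ u∈X | inj₂ w∈⁅v⁆ rewrite x∈⁅y⁆⇒x≡y v w∈⁅v⁆ = ∼-sym (v∼X u u∈X)
    ... | inj₂ u∈⁅v⁆ | inj₁ w∈X rewrite x∈⁅y⁆⇒x≡y v u∈⁅v⁆ = v∼X w w∈X
    ... | inj₂ u∈⁅v⁆ | inj₂ w∈⁅v⁆ =
      ⊥-elim (u≢w (trans (x∈⁅y⁆⇒x≡y v u∈⁅v⁆) (≡-sym (x∈⁅y⁆⇒x≡y v w∈⁅v⁆))))

  -- A chordal graph has no induced 4-cycle p q r s (adjacencies listed by pairs).
  no-C4 : Chordal H → ∀ {p q r s} →
          p ∼ q → p ≁ r → p ∼ s → q ∼ r → q ≁ s → r ∼ s → p ≢ r → q ≢ s → ⊥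
  no-C4 chordal {p} {q} {r} {s} p∼q p≁r p∼s q∼r q≁s r∼s p≢r q≢s =
    chordal 4 (s≤s (s≤s (s≤s (s≤s z≤n))))
      (cycle , injective-upper cycle apart , realises-upper c4-symmetric c4-irreflexive above)
    where
    cycle : Fin 4 → Vertex
    cycle #0 = p
    cycle #1 = q
    cycle #2 = r
    cycle #3 = s
    open Realisation H (cycleAdj 4) cycle
    c4-symmetric : ∀ i j → cycleAdj 4 i j ≡ cycleAdj 4 j i
    c4-symmetric = from-yes (Fin.all? λ i → Fin.all? λ j → cycleAdj 4 i j Bool.≟ cycleAdj 4 j i)
    c4-irreflexive : ∀ i → cycleAdj 4 i i ≡ false
    c4-irreflexive = from-yes (Fin.all? λ i → cycleAdj 4 i i Bool.≟ false)
    above : ∀ i j → toℕ i < toℕ j → adj H (cycle i) (cycle j) ≡ cycleAdj 4 i j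
    above #0 #1 _ = p∼q
    above #0 #2 _ = p≁r
    above #0 #3 _ = p∼s
    above #1 #2 _ = q∼r
    above #1 #3 _ = q≁s
    above #2 #3 _ = r∼s
    above _ #0 ()
    above (suc _) #1 (s≤s ())
    above #2 #2 (s≤s (s≤s ()))
    above #3 #2 (s≤s (s≤s ()))
    above #3 #3 (s≤s (s≤s (s≤s ())))
    apart : ∀ i j → toℕ i < toℕ j → cycle i ≢ cycle j
    apart #0 #1 _ = ∼-distinct p∼q
    apart #0 #2 _ = p≢r
    apart #0 #3 _ = ∼-distinct p∼s
    apart #1 #2 _ = ∼-distinct q∼r
    apart #1 #3 _ = q≢s
    apart #2 #3 _ = ∼-distinct r∼s
    apart _ #0 ()
    apart (suc _) #1 (s≤s ())
    apart #2 #2 (s≤s (s≤s ()))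
    apart #3 #2 (s≤s (s≤s ()))
    apart #3 #3 (s≤s (s≤s (s≤s ())))

  -- A vertex of a clique through u and w that is not adjacent to v.
  record Corner (v u w : Vertex) : Set where
    field
      apex   : Vertex
      v≢apex : v ≢ apex
      v≁apex : v ≁ apex
      u∼apex : u ∼ apex
      w∼apex : w ∼ apex

  swap : ∀ {v u w} → Corner v u w → Corner v w u
  swap c = record { apex = apex ; v≢apex = v≢apex ; v≁apex = v≁apex ; u∼apex = w∼apex ; w∼apex = u∼apex }
    where open Corner c

  corner : ∀ {X} → IsClique H X → ∀ {v u w} → v ∉ X → u ∈ X → w ∈ X → v ∼ u → v ∼ w →
           Corner v u w
  corner clique {v} v∉X u∈X w∈X v∼u v∼w with non-neighbour clique v∉X
  ... | a , a∈X , v≁a = record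
    { apex = a
    ; v≢apex = λ v≡a → ∈-∉-distinct a∈X v∉X (≡-sym v≡a)
    ; v≁apex = v≁a
    ; u∼apex = clique-∼ clique u∈X a∈X (separated v∼u v≁a)
    ; w∼apex = clique-∼ clique w∈X a∈X (separated v∼w v≁a) }

  -- Corners at adjacent vertices v, u are non-adjacent: an edge between them
  -- would close the induced 4-cycle v u a b.
  corners-nonadjacent : Chordal H → ∀ {v u w w'} → v ∼ u →
                        (p : Corner v u w) (q : Corner u v w') → Corner.apex p ≁ Corner.apex q
  corners-nonadjacent chordal v∼u p q with adj H (Corner.apex p) (Corner.apex q) in a∼b
  ... | false = refl
  ... | true = ⊥-elim (no-C4 chordal v∼u (Corner.v≁apex p) (Corner.u∼apex q)
                        (Corner.u∼apex p) (Corner.v≁apex q) a∼b (Corner.v≢apex p) (Corner.v≢apex q))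

  -- Three mutually adjacent vertices with pairwise non-adjacent corners span an
  -- induced Hajós graph: x, y, z = v₁, v₂, v₃ and a, b, c = the corners at v₃, v₂, v₁.
  hajos-of-corners : ∀ {v₁ v₂ v₃} → v₁ ∼ v₂ → v₁ ∼ v₃ → v₂ ∼ v₃ →
                     (c₁ : Corner v₁ v₂ v₃) (c₂ : Corner v₂ v₁ v₃) (c₃ : Corner v₃ v₁ v₂) →
                     Corner.apex c₃ ≁ Corner.apex c₂ → Corner.apex c₃ ≁ Corner.apex c₁ →
                     Corner.apex c₂ ≁ Corner.apex c₁ → HasInduced H 6 hajosAdj
  hajos-of-corners {v₁} {v₂} {v₃} v₁∼v₂ v₁∼v₃ v₂∼v₃ c₁ c₂ c₃ a₃≁a₂ a₃≁a₁ a₂≁a₁ =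
    hajos , realisation-injective hajos-twinFree realises , realises
    where
    open Corner
    hajos : Fin 6 → Vertex
    hajos #0 = v₁
    hajos #1 = v₂
    hajos #2 = v₃
    hajos #3 = apex c₃
    hajos #4 = apex c₂
    hajos #5 = apex c₁
    open Realisation H hajosAdj hajos
    hajos-twinFree : TwinFree hajosAdj
    hajos-twinFree = from-yes (Fin.all? λ i → Fin.all? λ j →
      Fin.all? (λ l → hajosAdj i l Bool.≟ hajosAdj j l) →-dec i Fin.≟ j)
    above : ∀ i j → toℕ i < toℕ j → adj H (hajos i) (hajos j) ≡ hajosAdj i j
    above #0 #1 _ = v₁∼v₂
    above #0 #2 _ = v₁∼v₃
    above #0 #3 _ = u∼apex c₃
    above #0 #4 _ = u∼apex c₂
    above #0 #5 _ = v≁apex c₁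
    above #1 #2 _ = v₂∼v₃
    above #1 #3 _ = w∼apex c₃
    above #1 #4 _ = v≁apex c₂
    above #1 #5 _ = u∼apex c₁
    above #2 #3 _ = v≁apex c₃
    above #2 #4 _ = w∼apex c₂
    above #2 #5 _ = w∼apex c₁
    above #3 #4 _ = a₃≁a₂
    above #3 #5 _ = a₃≁a₁
    above #4 #5 _ = a₂≁a₁
    above _ #0 ()
    above (suc _) #1 (s≤s ())
    above (suc (suc _)) #2 (s≤s (s≤s ()))
    above (suc (suc (suc _))) #3 (s≤s (s≤s (s≤s ())))
    above (suc (suc (suc (suc _)))) #4 (s≤s (s≤s (s≤s (s≤s ()))))
    above #5 #5 (s≤s (s≤s (s≤s (s≤s (s≤s ())))))
    realises : Realises
    realises = realises-upper (λ i j → Bool.∨-comm (hajosEdge i j) (hajosEdge j i))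
                 (from-yes (Fin.all? λ i → hajosAdj i i Bool.≟ false)) above

  -- In a chordal Hajós-free graph there is no triangle of cliques: its points
  -- are pairwise adjacent and the three corners would span a Hajós graph.
  no-clique-triangle : Chordal H → HajosFree H → ∀ {X₁ X₂ X₃} →
                       IsClique H X₁ → IsClique H X₂ → IsClique H X₃ → ¬ Triangle X₁ X₂ X₃
  no-clique-triangle chordal hajosFree clique₁ clique₂ clique₃ t =
    hajosFree (hajos-of-corners v₁∼v₂ v₁∼v₃ v₂∼v₃ c₁ c₂ c₃
      (corners-nonadjacent chordal (∼-sym v₂∼v₃) (swap c₃) (swap c₂))
      (corners-nonadjacent chordal (∼-sym v₁∼v₃) c₃ (swap c₁))
      (corners-nonadjacent chordal (∼-sym v₁∼v₂) c₂ c₁))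
    where
    open Triangle t
    v₁∼v₂ = clique-∼ clique₃ v₁∈X₃ v₂∈X₃ (∈-∉-distinct v₁∈X₂ v₂∉X₂)
    v₁∼v₃ = clique-∼ clique₂ v₁∈X₂ v₃∈X₂ (∈-∉-distinct v₁∈X₃ v₃∉X₃)
    v₂∼v₃ = clique-∼ clique₁ v₂∈X₁ v₃∈X₁ (∈-∉-distinct v₂∈X₃ v₃∉X₃)
    c₁ = corner clique₁ v₁∉X₁ v₂∈X₁ v₃∈X₁ v₁∼v₂ v₁∼v₃
    c₂ = corner clique₂ v₂∉X₂ v₁∈X₂ v₃∈X₂ (∼-sym v₁∼v₂) v₂∼v₃
    c₃ = corner clique₃ v₃∉X₃ v₁∈X₃ v₂∈X₃ (∼-sym v₁∼v₃) (∼-sym v₂∼v₃)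

  -- S is an intersection of cliques: each vertex outside S is missed by a
  -- clique containing S.
  CliqueConvex : Subset (n H) → Set
  CliqueConvex S = ∀ v → v ∉ S → ∃[ X ] (IsClique H X × S ⊆ X × v ∉ X)

  ∩-cliqueConvex : ∀ {C D} → IsClique H C → IsClique H D → CliqueConvex (C ∩ D)
  ∩-cliqueConvex {C} {D} clique-C clique-D v v∉C∩D with v ∈? C
  ... | yes v∈C = D , clique-D , (λ w∈ → proj₂ (x∈p∩q⁻ C D w∈)) , (λ v∈D → v∉C∩D (x∈p∩q⁺ (v∈C , v∈D)))
  ... | no v∉C = C , clique-C , (λ w∈ → proj₁ (x∈p∩q⁻ C D w∈)) , v∉C

  -- A family of intersections of cliques in a chordal Hajós-free graph is
  -- Helly: a triangle in it enlarges to a triangle of cliques.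
  cliqueConvex-helly : Chordal H → HajosFree H → ∀ {k} (F : Fin k → Subset (n H)) →
                       (∀ a → CliqueConvex (F a)) → Helly F
  cliqueConvex-helly chordal hajosFree F convex = helly-of-triangle-free F no-triangle
    where
    no-triangle : ∀ a b c → ¬ Triangle (F a) (F b) (F c)
    no-triangle a b c t
      with convex a (Triangle.v₁ t) (Triangle.v₁∉X₁ t)
         | convex b (Triangle.v₂ t) (Triangle.v₂∉X₂ t)
         | convex c (Triangle.v₃ t) (Triangle.v₃∉X₃ t)
    ... | X₁ , clique₁ , Fa⊆X₁ , v₁∉X₁ | X₂ , clique₂ , Fb⊆X₂ , v₂∉X₂ | X₃ , clique₃ , Fc⊆X₃ , v₃∉X₃ =
      no-clique-triangle chordal hajosFree clique₁ clique₂ clique₃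
        (triangle-enlarge t Fa⊆X₁ Fb⊆X₂ Fc⊆X₃ v₁∉X₁ v₂∉X₂ v₃∉X₃)

  -- Every separator label C ∩ D of a clique forest is an intersection of cliques.
  separators-helly : Chordal H → HajosFree H → SHelly H
  separators-helly chordal hajosFree T =
    cliqueConvex-helly chordal hajosFree labels
      (λ a → ∩-cliqueConvex (isClique _) (isClique _))
    where open CliqueForest T

pattern x̂ = #0
pattern ŷ = #1

-- Its cliques {x,y,z}, {x,y,a}, {x,z,b}, {y,z,c}.
pattern centre = #0

hajosClique : Fin 4 → Subset 6
hajosClique #0 = inside  ∷ inside  ∷ inside  ∷ outside ∷ outside ∷ outside ∷ []
hajosClique #1 = inside  ∷ inside  ∷ outside ∷ inside  ∷ outside ∷ outside ∷ []
hajosClique #2 = inside  ∷ outside ∷ inside  ∷ outside ∷ inside  ∷ outside ∷ []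
hajosClique #3 = outside ∷ inside  ∷ inside  ∷ outside ∷ outside ∷ inside  ∷ []

starEdges : List (Fin 4 × Fin 4)
starEdges = (centre , #1) ∷ (centre , #2) ∷ (centre , #3) ∷ []

-- Its edge labels {x,y}, {x,z}, {y,z}.
starLabel : Fin 3 → Subset 6
starLabel e = hajosClique (proj₁ (lookup starEdges e)) ∩ hajosClique (proj₂ (lookup starEdges e))

HajosComplete : Subset 6 → Set
HajosComplete C = ∀ u v → u ∈ C → v ∈ C → u ≢ v → hajosAdj u v ≡ true

module HajosPattern where

  complete? : ∀ C → Dec (HajosComplete C)
  complete? C = Fin.all? λ u → Fin.all? λ v →
    (u ∈? C) →-dec (v ∈? C) →-dec ¬? (u Fin.≟ v) →-dec (hajosAdj u v Bool.≟ true)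

  cliques-complete : ∀ i → HajosComplete (hajosClique i)
  cliques-complete = from-yes (Fin.all? λ i → complete? (hajosClique i))

  cliques-nonempty : ∀ i → Nonempty (hajosClique i)
  cliques-nonempty = from-yes (Fin.all? λ i → nonempty? (hajosClique i))

  cliques-maximal : ∀ i u → u ∉ hajosClique i → ∃[ w ] (w ∈ hajosClique i × hajosAdj u w ≡ false)
  cliques-maximal = from-yes (Fin.all? λ i → Fin.all? λ u → ¬? (u ∈? hajosClique i) →-dec
    Fin.any? λ w → (w ∈? hajosClique i) ×-dec (hajosAdj u w Bool.≟ false))

  cliques-distinct : ∀ i j → hajosClique i ≡ hajosClique j → i ≡ j
  cliques-distinct = from-yes (Fin.all? λ i → Fin.all? λ j →
    Vec.≡-dec Bool._≟_ (hajosClique i) (hajosClique j) →-dec i Fin.≟ j)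

  complete-covered : ∀ C → HajosComplete C → Nonempty C → ∃[ i ] C ⊆ hajosClique i
  complete-covered C complete nonempty with Fin.any? (λ i → C ⊆? hajosClique i)
  ... | yes covered = covered
  ... | no uncovered = ⊥-elim (no-uncovered (C , complete , nonempty , uncovered))
    where
    no-uncovered : ¬ (∃[ C ] (HajosComplete C × Nonempty C × ¬ (∃[ i ] C ⊆ hajosClique i)))
    no-uncovered = from-no (anySubset? λ C →
      complete? C ×-dec nonempty? C ×-dec ¬? (Fin.any? λ i → C ⊆? hajosClique i))

  labels-pairwise : ∀ e f → Nonempty (starLabel e ∩ starLabel f)
  labels-pairwise = from-yes (Fin.all? λ e → Fin.all? λ f → nonempty? (starLabel e ∩ starLabel f))

  labels-disjoint : ¬ (∃[ v ] (∀ e → v ∈ starLabel e))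
  labels-disjoint = from-no (Fin.any? λ v → Fin.all? λ e → v ∈? starLabel e)

StarAdj : Fin 4 → Fin 4 → Set
StarAdj i j = ((i , j) L.∈ starEdges) ⊎ ((j , i) L.∈ starEdges)

StarPath : Fin 4 → Fin 4 → List (Fin 4) → Set
StarPath i j p = Linked StarAdj p × Unique p × head p ≡ just i × last p ≡ just j

SameStarEdge : (Fin 4 × Fin 4) → (Fin 4 × Fin 4) → Set
SameStarEdge (i , j) (k , l) = (i ≡ k × j ≡ l) ⊎ (i ≡ l × j ≡ k)

starRoute : Fin 4 → Fin 4 → List (Fin 4)
starRoute #0 #0 = #0 ∷ []
starRoute #1 #1 = #1 ∷ []
starRoute #2 #2 = #2 ∷ []
starRoute #3 #3 = #3 ∷ []
starRoute centre j = centre ∷ j ∷ []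
starRoute i centre = i ∷ centre ∷ []
starRoute i j = i ∷ centre ∷ j ∷ []

module Star where

  adj? : ∀ i j → Dec (StarAdj i j)
  adj? i j = any? (Product.≡-dec Fin._≟_ Fin._≟_ (i , j)) starEdges
        ⊎-dec any? (Product.≡-dec Fin._≟_ Fin._≟_ (j , i)) starEdges

  path? : ∀ i j p → Dec (StarPath i j p)
  path? i j p = linked? adj? p ×-dec allPairs? (λ x y → ¬? (x Fin.≟ y)) p
    ×-dec Maybe.≡-dec Fin._≟_ (head p) (just i) ×-dec Maybe.≡-dec Fin._≟_ (last p) (just j)

  route? : (p q : List (Fin 4)) → Dec (p ≡ q)
  route? = List.≡-dec Fin._≟_

  no-loop : ∀ i → ¬ StarAdj i i
  no-loop = from-yes (Fin.all? λ i → ¬? (adj? i i))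

  simple : ∀ a b → SameStarEdge (lookup starEdges a) (lookup starEdges b) → a ≡ b
  simple = from-yes (Fin.all? λ a → Fin.all? λ b →
    let (i , j) = lookup starEdges a ; (k , l) = lookup starEdges b in
    ((i Fin.≟ k ×-dec j Fin.≟ l) ⊎-dec (i Fin.≟ l ×-dec j Fin.≟ k)) →-dec a Fin.≟ b)

  edge-at-centre : ∀ i j → StarAdj i j → i ≡ centre ⊎ j ≡ centre
  edge-at-centre = from-yes (Fin.all? λ i → Fin.all? λ j →
    adj? i j →-dec (i Fin.≟ centre ⊎-dec j Fin.≟ centre))

  route-trivial : ∀ i → i ∷ [] ≡ starRoute i i
  route-trivial = from-yes (Fin.all? λ i → route? (i ∷ []) (starRoute i i))

  route-edge : ∀ i j → StarAdj i j → i ∷ j ∷ [] ≡ starRoute i j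
  route-edge = from-yes (Fin.all? λ i → Fin.all? λ j →
    adj? i j →-dec route? (i ∷ j ∷ []) (starRoute i j))

  route-through-centre : ∀ i j → i ≢ centre → j ≢ centre → i ≢ j →
                         i ∷ centre ∷ j ∷ [] ≡ starRoute i j
  route-through-centre = from-yes (Fin.all? λ i → Fin.all? λ j →
    ¬? (i Fin.≟ centre) →-dec ¬? (j Fin.≟ centre) →-dec ¬? (i Fin.≟ j) →-dec
    route? (i ∷ centre ∷ j ∷ []) (starRoute i j))

  route-path : ∀ i j → StarPath i j (starRoute i j)
  route-path = from-yes (Fin.all? λ i → Fin.all? λ j → path? i j (starRoute i j))

  route-intersection : ∀ i j k → k L.∈ starRoute i j →
                       hajosClique i ∩ hajosClique j ⊆ hajosClique k
  route-intersection = from-yes (Fin.all? λ i → Fin.all? λ j → Fin.all? λ k →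
    any? (k Fin.≟_) (starRoute i j) →-dec (hajosClique i ∩ hajosClique j ⊆? hajosClique k))

  -- Simple paths in the star are unique: every edge meets the centre, so a
  -- simple path has at most three vertices and is the route between its ends.
  path-unique : ∀ {i j} p → StarPath i j p → p ≡ starRoute i j
  path-unique [] (_ , _ , () , _)
  path-unique (x ∷ []) (_ , _ , refl , refl) = route-trivial x
  path-unique (x ∷ y ∷ []) (x~y ∷ [-] , _ , refl , refl) = route-edge x y x~y
  path-unique (x ∷ y ∷ z ∷ []) (x~y ∷ y~z ∷ [-] , (x≢y ∷ x≢z ∷ _) ∷ (y≢z ∷ _) ∷ _ , refl , refl)
    with edge-at-centre x y x~y | edge-at-centre y z y~z
  ... | inj₁ refl | inj₁ refl = ⊥-elim (x≢y refl)
  ... | inj₁ refl | inj₂ refl = ⊥-elim (x≢z refl)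
  ... | inj₂ refl | inj₂ refl = ⊥-elim (y≢z refl)
  ... | inj₂ refl | inj₁ _ =
    route-through-centre x z (λ x≡c → x≢y x≡c) (λ z≡c → y≢z (≡-sym z≡c)) x≢z
  path-unique (x ∷ y ∷ z ∷ w ∷ _)
    (x~y ∷ _ ∷ z~w ∷ _ , (_ ∷ x≢z ∷ x≢w ∷ _) ∷ (y≢z ∷ y≢w ∷ _) ∷ _ , _)
    with edge-at-centre x y x~y | edge-at-centre z w z~w
  ... | inj₁ refl | inj₁ refl = ⊥-elim (x≢z refl)
  ... | inj₁ refl | inj₂ refl = ⊥-elim (x≢w refl)
  ... | inj₂ refl | inj₁ refl = ⊥-elim (y≢z refl)
  ... | inj₂ refl | inj₂ refl = ⊥-elim (y≢w refl)

module HajosCopy (G : Graph) (h : Fin 6 → Fin (n G))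
                 (h-realises : ∀ i j → adj G (h i) (h j) ≡ hajosAdj i j) where

  Copy : Graph
  Copy = induced G 6 h

  complete-pattern : ∀ {C} → IsComplete Copy C → HajosComplete C
  complete-pattern complete u v u∈ v∈ u≢v = trans (≡-sym (h-realises u v)) (complete u v u∈ v∈ u≢v)

  pattern-complete : ∀ {C} → HajosComplete C → IsComplete Copy C
  pattern-complete complete u v u∈ v∈ u≢v = trans (h-realises u v) (complete u v u∈ v∈ u≢v)

  isClique : ∀ i → IsClique Copy (hajosClique i)
  isClique i = pattern-complete (HajosPattern.cliques-complete i) , HajosPattern.cliques-nonempty i , maximal
    where
    maximal : ∀ D → IsComplete Copy D → hajosClique i ⊆ D → D ⊆ hajosClique i
    maximal D complete K⊆D {u} u∈D with u ∈? hajosClique i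
    ... | yes u∈K = u∈K
    ... | no u∉K with HajosPattern.cliques-maximal i u u∉K
    ...   | w , w∈K , u≁w =
      ⊥-elim (false≢true (trans (≡-sym u≁w) (complete-pattern complete u w u∈D (K⊆D w∈K) u≢w)))
      where
      u≢w : u ≢ w
      u≢w refl = u∉K w∈K

  allCliques : ∀ C → IsClique Copy C → ∃[ i ] hajosClique i ≡ C
  allCliques C (complete , nonempty , maximal)
    with HajosPattern.complete-covered C (complete-pattern complete) nonempty
  ... | i , C⊆K = i , ⊆-antisym (maximal (hajosClique i) (proj₁ (isClique i)) C⊆K) C⊆K

  -- every clique contains x or y, and x ∼ y: all cliques lie in one component
  representative : Fin 4 → Fin 6
  representative #3 = ŷ
  representative _ = x̂

  representative-∈ : ∀ i → representative i ∈ hajosClique i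
  representative-∈ #0 = here
  representative-∈ #1 = here
  representative-∈ #2 = here
  representative-∈ #3 = there here

  to-x : ∀ i → Connected Copy (representative i) x̂
  to-x #0 = ε
  to-x #1 = ε
  to-x #2 = ε
  to-x #3 = h-realises ŷ x̂ ◅ ε

  from-x : ∀ i → Connected Copy x̂ (representative i)
  from-x #0 = ε
  from-x #1 = ε
  from-x #2 = ε
  from-x #3 = h-realises x̂ ŷ ◅ ε

  star : CliqueForest Copy
  star = record
    { m            = 4
    ; clique       = hajosClique
    ; isClique     = isClique
    ; injC         = λ {i} {j} → HajosPattern.cliques-distinct i j
    ; allC         = allCliques
    ; edges        = starEdges
    ; noLoop       = Star.no-loop
    ; noMultiEdge  = Star.simple
    ; acyclic      = λ i j p q p-path q-path →
                       trans (Star.path-unique p p-path) (≡-sym (Star.path-unique q q-path))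
    ; components   = λ i j → mk⇔
        (λ _ → representative i , representative j , representative-∈ i , representative-∈ j
             , to-x i ◅◅ from-x j)
        (λ _ → starRoute i j , Star.route-path i j)
    ; intersection = λ i j p p-path k k∈p →
        Star.route-intersection i j k (subst (k L.∈_) (Star.path-unique p p-path) k∈p)
    }

  not-helly : ¬ Helly (CliqueForest.labels star)
  not-helly helly with helly ⊤ (zero , ∈⊤) (λ e f _ _ → HajosPattern.labels-pairwise e f)
  ... | v , common = HajosPattern.labels-disjoint (v , λ e → common e ∈⊤)

theorem2p10 : (G : Graph) → Chordal G →
    ((∀ (m : ℕ) (f : Fin m → Fin (n G)) → Injective _≡_ _≡_ f →
        SHelly (induced G m f))
     ⇔ HajosFree G)
theorem2p10 G chordal = mk⇔ hajos-free helly
  where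
  hajos-free : (∀ m f → Injective _≡_ _≡_ f → SHelly (induced G m f)) → HajosFree G
  hajos-free all-helly (h , h-injective , h-realises) =
    HajosCopy.not-helly G h h-realises (all-helly 6 h h-injective (HajosCopy.star G h h-realises))

  -- induced subgraphs stay chordal and Hajós-free, so their separators are Helly
  helly : HajosFree G → ∀ m f → Injective _≡_ _≡_ f → SHelly (induced G m f)
  helly hajosFree m f f-injective =
    Cliques.separators-helly (induced G m f)
      (chordal-induced G m f f-injective chordal)
      (hajosFree-induced G m f f-injective hajosFree)
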